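{- Let $G$ be a graph with an odd number $n\geq 9$ of vertices. Then $\mathrm{mp}(G)=2n-3$ if and only if $G$ is a complete graph.
   Context: All graphs are finite, simple and undirected. A perfect matching is a set of edges covering every vertex exactly once; an almost-perfect matching is a set of edges covering every vertex except one exactly once and missing the remaining vertex. The matching preclusion number $\mathrm{mp}(G)$ is the minimum number of edges whose deletion leaves a graph with neither a perfect matching nor an almost-perfect matching ($\mathrm{mp}(G)=0$ if $G$ has neither). -}

module Defs where

open import Data.Nat using (ℕ; zero; suc; _+_; _≤_)
open import Data.Fin using (Fin; zero; suc; _<?_)
open import Data.Bool using (Bool; true; false; _∧_; not; if_then_else_)
open import Data.Product using (Σ; _×_; ∃-syntax)
open import Relation.Nullary using (¬_)
open import Relation.Nullary.Decidable using (⌊_⌋)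
open import Relation.Binary.PropositionalEquality using (_≡_; _≢_; refl)

count : {n : ℕ} → (Fin n → Bool) → ℕ
count {zero}  p = 0
count {suc n} p = (if p zero then 1 else 0) + count (λ i → p (suc i))

sumFin : {n : ℕ} → (Fin n → ℕ) → ℕ
sumFin {zero}  f = 0
sumFin {suc n} f = f zero + sumFin (λ i → f (suc i))

record Graph (n : ℕ) : Set where
  field
    adj   : Fin n → Fin n → Bool
    sym   : ∀ i j → adj i j ≡ adj j i
    irrefl : ∀ i → adj i i ≡ false
open Graph public

_⊆_ : {n : ℕ} → Graph n → Graph n → Set
H ⊆ G = ∀ i j → adj H i j ≡ true → adj G i j ≡ true

edgeCount : {n : ℕ} → Graph n → ℕ
edgeCount G = sumFin (λ i → count (λ j → adj G i j ∧ ⌊ j <? i ⌋))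

_∖_ : {n : ℕ} → Graph n → Graph n → Graph n
adj (G ∖ F) i j = adj G i j ∧ not (adj F i j)
sym (G ∖ F) i j rewrite sym G i j | sym F i j = refl
irrefl (G ∖ F) i rewrite irrefl G i = refl

degree : {n : ℕ} → Graph n → Fin n → ℕ
degree M i = count (adj M i)

IsPerfectMatching : {n : ℕ} → Graph n → Graph n → Set
IsPerfectMatching H M = (M ⊆ H) × (∀ i → degree M i ≡ 1)

IsAlmostPerfectMatching : {n : ℕ} → Graph n → Graph n → Set
IsAlmostPerfectMatching {n} H M =
  (M ⊆ H) × ∃[ v ] ((degree M v ≡ 0) × (∀ i → i ≢ v → degree M i ≡ 1))

NoPMNoAPM : {n : ℕ} → Graph n → Set
NoPMNoAPM {n} H = (¬ (∃[ M ] IsPerfectMatching H M)) × (¬ (∃[ M ] IsAlmostPerfectMatching H M))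

MatchingPreclusionNumber : {n : ℕ} → Graph n → ℕ → Set
MatchingPreclusionNumber {n} G k =
  (∃[ F ] ((F ⊆ G) × (edgeCount F ≡ k) × NoPMNoAPM (G ∖ F)))
  × (∀ (F : Graph n) → F ⊆ G → NoPMNoAPM (G ∖ F) → k ≤ edgeCount F)

IsComplete : {n : ℕ} → Graph n → Set
IsComplete G = ∀ i j → i ≢ j → adj G i j ≡ true

module Submission where

-- For distinct vertices i, j let Star G i j be the set of edges meeting i or
-- j.  Deleting it isolates i and j, so no perfect or almost-perfect matching
-- survives (starDeletion).
--   (⇒) If i, j were non-adjacent, their star would have at most
--       2(n − 2) < 2n − 3 edges (nonAdjacentStar), against minimality.
--   (⇐) In Kₙ the star of two vertices has exactly 2n − 3 edges
--       (completeStar).  Minimality is the main lemma almostPerfectMatching: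
--       deleting at most capacity k edges from K_{2k+1} leaves an
--       almost-perfect matching, where capacity k = 4k − 2 = 2n − 4 for k ≥ 4.
--       It is proved by induction on k, removing a "good pair" of vertices
--       joined by a surviving edge (goodPair).  Good pairs exist by a
--       maximum-degree argument whose numerical core (impossibleA/B/C) is
--       checked by a finite search for k ≤ 3 and by algebra for k ≥ 4.
-- Edge counts and degree sums are related by the handshake lemma.

open import Defs
open import Data.Nat using (ℕ; zero; suc; _+_; _*_; _∸_; _%_; _/_; _≤_; _<_; z≤n; s≤s; _≤ᵇ_; _≤?_)
open import Data.Nat.Properties hiding (_<?_; _≟_)
open import Data.Nat.DivMod using (m≡m%n+[m/n]*n)
open import Data.Fin using (Fin; zero; suc; _<?_; _≟_)
open import Data.Bool using (Bool; true; false; _∧_; _∨_; not; if_then_else_)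
open import Data.Bool.Properties using (T-≡; ∨-comm; ∧-comm; ∨-identityʳ; ∨-zeroʳ; ∧-zeroʳ) renaming (_≟_ to _≟ᵇ_)
open import Data.Fin.Properties using (any?) renaming (<-asym to F<-asym; <-cmp to F<-cmp)
open import Relation.Binary using (tri<; tri≈; tri>)
open import Data.Sum using (_⊎_; inj₁; inj₂)
open import Data.Product using (_×_; _,_; proj₁; proj₂; Σ; ∃; ∃-syntax)
open import Function.Bundles using (Equivalence)
open import Data.Empty using (⊥; ⊥-elim)
open import Relation.Nullary using (¬_; yes; no; Dec)
open import Relation.Nullary.Decidable using (_×-dec_; ⌊_⌋)
open import Data.Nat.Tactic.RingSolver using (solve-∀)
open import Relation.Binary.PropositionalEquality renaming (sym to ≡sym)
open import Algebra.Properties.CommutativeSemigroup +-commutativeSemigroup using (interchange)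

when : Bool → ℕ → ℕ
when true  a = a
when false a = 0

when-+ : ∀ b x y → when b (x + y) ≡ when b x + when b y
when-+ true  x y = refl
when-+ false x y = refl

when-∧ : ∀ b c a → when b (when c a) ≡ when (b ∧ c) a
when-∧ true  c a = refl
when-∧ false c a = refl

when-≤ : ∀ b a → when b a ≤ a
when-≤ true  a = ≤-refl
when-≤ false a = z≤n

when-scale : ∀ b a → when b a ≡ a * when b 1
when-scale true  a = ≡sym (*-identityʳ a)
when-scale false a = ≡sym (*-zeroʳ a)

-- Boolean equality on Fin, by recursion so that point masses compute.
_==_ : ∀ {n} → Fin n → Fin n → Bool
zero  == zero  = true
zero  == suc _ = false
suc _ == zero  = false
suc i == suc j = i == j

==-refl : ∀ {n} (i : Fin n) → (i == i) ≡ true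
==-refl zero    = refl
==-refl (suc i) = ==-refl i

==⇒≡ : ∀ {n} {i j : Fin n} → (i == j) ≡ true → i ≡ j
==⇒≡ {i = zero}  {zero}  e = refl
==⇒≡ {i = suc i} {suc j} e = cong suc (==⇒≡ e)

==-false⇒≢ : ∀ {n} {i j : Fin n} → (i == j) ≡ false → i ≢ j
==-false⇒≢ {i = i} e refl with () ← trans (≡sym (==-refl i)) e

≢⇒==-false : ∀ {n} {i j : Fin n} → i ≢ j → (i == j) ≡ false
≢⇒==-false {i = i} {j} i≢j with i == j in e
... | true  = ⊥-elim (i≢j (==⇒≡ e))
... | false = refl

==-false-comm : ∀ {n} (i j : Fin n) → (i == j) ≡ false → (j == i) ≡ false
==-false-comm i j e = ≢⇒==-false {i = j} {j = i} (λ j≡i → ==-false⇒≢ {i = i} {j = j} e (≡sym j≡i))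

sum-cong : ∀ {n} {f g : Fin n → ℕ} → (∀ i → f i ≡ g i) → sumFin f ≡ sumFin g
sum-cong {zero}  h = refl
sum-cong {suc n} h = cong₂ _+_ (h zero) (sum-cong (λ i → h (suc i)))

sum-mono : ∀ {n} {f g : Fin n → ℕ} → (∀ i → f i ≤ g i) → sumFin f ≤ sumFin g
sum-mono {zero}  h = z≤n
sum-mono {suc n} h = +-mono-≤ (h zero) (sum-mono (λ i → h (suc i)))

sum-zero : ∀ n → sumFin {n} (λ _ → 0) ≡ 0
sum-zero zero    = refl
sum-zero (suc n) = sum-zero n

sum-ones : ∀ n → sumFin {n} (λ _ → 1) ≡ n
sum-ones zero    = refl
sum-ones (suc n) = cong suc (sum-ones n)

sum-+ : ∀ {n} (f g : Fin n → ℕ) → sumFin (λ i → f i + g i) ≡ sumFin f + sumFin g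
sum-+ {zero}  f g = refl
sum-+ {suc n} f g =
  trans (cong (f zero + g zero +_) (sum-+ (λ i → f (suc i)) (λ i → g (suc i))))
        (interchange (f zero) (g zero) _ _)

sum-* : ∀ {n} (c : ℕ) (f : Fin n → ℕ) → sumFin (λ i → c * f i) ≡ c * sumFin f
sum-* {zero}  c f = ≡sym (*-zeroʳ c)
sum-* {suc n} c f = trans (cong (c * f zero +_) (sum-* c (λ i → f (suc i))))
                          (≡sym (*-distribˡ-+ c (f zero) _))

sum-when : ∀ {n} (p : Fin n → Bool) (a : ℕ) →
           sumFin (λ i → when (p i) a) ≡ a * sumFin (λ i → when (p i) 1)
sum-when p a = trans (sum-cong (λ i → when-scale (p i) a)) (sum-* a (λ i → when (p i) 1))

sum-point : ∀ {n} (u : Fin n) (h : Fin n → ℕ) → sumFin (λ i → when (i == u) (h i)) ≡ h u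
sum-point {suc n} zero    h = trans (cong (h zero +_) (sum-zero n)) (+-identityʳ _)
sum-point {suc n} (suc u) h = sum-point u (λ i → h (suc i))

sum-swap : ∀ {n m} (g : Fin n → Fin m → ℕ) →
  sumFin (λ i → sumFin (λ j → g i j)) ≡ sumFin (λ j → sumFin (λ i → g i j))
sum-swap {zero}  {m} g = ≡sym (sum-zero m)
sum-swap {suc n}     g =
  trans (cong (sumFin (λ j → g zero j) +_) (sum-swap (λ i j → g (suc i) j)))
        (≡sym (sum-+ (λ j → g zero j) (λ j → sumFin (λ i → g (suc i) j))))

count-sum : ∀ {n} (p : Fin n → Bool) → count p ≡ sumFin (λ i → when (p i) 1)
count-sum {zero}  p = refl
count-sum {suc n} p = cong₂ _+_ (ifte (p zero)) (count-sum (λ i → p (suc i)))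
  where ifte : ∀ b → (if b then 1 else 0) ≡ when b 1
        ifte true  = refl
        ifte false = refl

∧-left : ∀ {a b} → a ∧ b ≡ true → a ≡ true
∧-left {true} _ = refl

∧-right : ∀ {a b} → a ∧ b ≡ true → b ≡ true
∧-right {true} e = e

false≢true : false ≢ true
false≢true ()

true-or-false : ∀ {b} → ¬ (b ≡ true) → b ≡ false
true-or-false {true}  h = ⊥-elim (h refl)
true-or-false {false} h = refl

∨-cases : ∀ {a b} → a ∨ b ≡ true → (a ≡ true) ⊎ (b ≡ true)
∨-cases {true}  e = inj₁ refl
∨-cases {false} e = inj₂ e

when-∨ : ∀ a b → (a ≡ true → b ≡ false) → when (a ∨ b) 1 ≡ when a 1 + when b 1
when-∨ true  b disjoint rewrite disjoint refl = refl
when-∨ false b disjoint = refl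

argmax : ∀ {n} (S : Fin n → Bool) (h : Fin n → ℕ) (x₀ : Fin n) → S x₀ ≡ true →
         Σ (Fin n) λ u → S u ≡ true × (∀ x → S x ≡ true → h x ≤ h u)
argmax {suc n} S h x₀ Sx₀ with any? (λ i → S (suc i) ≟ᵇ true)
... | no none = zero , zero-in x₀ Sx₀ , λ { zero _ → ≤-refl ; (suc i) e → ⊥-elim (none (i , e)) }
  where
    zero-in : ∀ x → S x ≡ true → S zero ≡ true
    zero-in zero    e = e
    zero-in (suc i) e = ⊥-elim (none (i , e))
... | yes (t , St) with argmax (λ i → S (suc i)) (λ i → h (suc i)) t St
...   | u , Su , max with S zero in S0 | h (suc u) ≤? h zero
...     | true  | yes le = zero , S0 , λ { zero _ → ≤-refl ; (suc i) e → ≤-trans (max i e) le }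
...     | true  | no gt  = suc u , Su , λ { zero _ → <⇒≤ (≰⇒> gt) ; (suc i) e → max i e }
...     | false | _      = suc u , Su , λ { zero e → ⊥-elim (false≢true (trans (≡sym S0) e)) ; (suc i) e → max i e }

-- Degrees with respect to a symmetric irreflexive relation F (in the
-- application: the deleted edges), restricted to a vertex set S.  deg S x
-- counts the F-neighbours of x in S, degSum S = Σ_{x ∈ S} deg S x is twice
-- the number of F-edges inside S, and S ⊖ u is S without u.
module RestrictedDegrees {n : ℕ} (F : Fin n → Fin n → Bool)
    (F-sym : ∀ i j → F i j ≡ F j i) (F-irrefl : ∀ i → F i i ≡ false) where

  VSet : Set
  VSet = Fin n → Bool

  size : VSet → ℕ
  size S = sumFin (λ x → when (S x) 1)

  deg : VSet → Fin n → ℕ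
  deg S x = sumFin (λ y → when (S y ∧ F x y) 1)

  degSum : VSet → ℕ
  degSum S = sumFin (λ x → when (S x) (deg S x))

  infixl 6 _⊖_
  _⊖_ : VSet → Fin n → VSet
  (S ⊖ u) x = S x ∧ not (x == u)

  ⊖-≢ : ∀ S u x → (S ⊖ u) x ≡ true → (x == u) ≡ false
  ⊖-≢ S u x e with S x | x == u
  ... | true  | false = refl
  ... | true  | true  = ⊥-elim (false≢true e)
  ... | false | _     = ⊥-elim (false≢true e)

  ⊖-keeps : ∀ S u v → S v ≡ true → (v == u) ≡ false → (S ⊖ u) v ≡ true
  ⊖-keeps S u v Sv vu rewrite Sv | vu = refl

  nonempty : ∀ S m → size S ≡ suc m → Σ (Fin n) λ x → S x ≡ true
  nonempty S m e with any? (λ x → S x ≟ᵇ true)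
  ... | yes p   = p
  ... | no none = ⊥-elim (0≢1+n (trans (≡sym empty) e))
    where empty : size S ≡ 0
          empty = trans (sum-cong (λ x → cong (λ b → when b 1) (true-or-false (λ Sx → none (x , Sx)))))
                        (sum-zero n)

  size-≥1 : ∀ S x → S x ≡ true → 1 ≤ size S
  size-≥1 S x Sx = ≤-trans (≤-reflexive (≡sym (sum-point x (λ _ → 1)))) (sum-mono pointwise)
    where pointwise : ∀ y → when (y == x) 1 ≤ when (S y) 1
          pointwise y with y == x in yx
          ... | false = z≤n
          ... | true  = ≤-reflexive (cong (λ b → when b 1) (≡sym (trans (cong S (==⇒≡ yx)) Sx)))

  deg-≤-size : ∀ S x → deg S x ≤ size S
  deg-≤-size S x = sum-mono pointwise
    where pointwise : ∀ y → when (S y ∧ F x y) 1 ≤ when (S y) 1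
          pointwise y with S y
          ... | true  = when-≤ (F x y) 1
          ... | false = z≤n

  when-split : ∀ S u → S u ≡ true → ∀ x a → when (S x) a ≡ when ((S ⊖ u) x) a + when (x == u) a
  when-split S u Su x a with S x in Sx | x == u in xu
  ... | true  | true  = refl
  ... | true  | false = ≡sym (+-identityʳ _)
  ... | false | true  = ⊥-elim (false≢true (trans (≡sym Sx) (trans (cong S (==⇒≡ xu)) Su)))
  ... | false | false = refl

  size-⊖ : ∀ S u → S u ≡ true → size S ≡ size (S ⊖ u) + 1
  size-⊖ S u Su = trans (sum-cong (λ x → when-split S u Su x 1))
                 (trans (sum-+ {n} _ _) (cong (size (S ⊖ u) +_) (sum-point u (λ _ → 1))))

  size-⊖-pred : ∀ S u m → S u ≡ true → size S ≡ m + 1 → size (S ⊖ u) ≡ m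
  size-⊖-pred S u m Su e = +-cancelʳ-≡ 1 _ _ (trans (≡sym (size-⊖ S u Su)) e)

  deg-⊖ : ∀ S u → S u ≡ true → ∀ x → deg S x ≡ deg (S ⊖ u) x + when (F x u) 1
  deg-⊖ S u Su x = trans (sum-cong split)
    (trans (sum-+ {n} _ _) (cong (deg (S ⊖ u) x +_) (sum-point u (λ y → when (F x y) 1))))
    where
      split : ∀ y → when (S y ∧ F x y) 1 ≡ when ((S ⊖ u) y ∧ F x y) 1 + when (y == u) (when (F x y) 1)
      split y = trans (≡sym (when-∧ (S y) (F x y) 1))
                (trans (when-split S u Su y _) (cong (_+ _) (when-∧ ((S ⊖ u) y) (F x y) 1)))

  deg-⊖-self : ∀ S u → S u ≡ true → deg S u ≡ deg (S ⊖ u) u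
  deg-⊖-self S u Su = trans (deg-⊖ S u Su u)
    (trans (cong (λ b → deg (S ⊖ u) u + when b 1) (F-irrefl u)) (+-identityʳ _))

  -- Removing u from S removes the 2 · deg S u endpoints of F-edges at u.
  degSum-⊖ : ∀ S u → S u ≡ true → degSum S ≡ degSum (S ⊖ u) + (deg S u + deg S u)
  degSum-⊖ S u Su = begin
      degSum S
    ≡⟨ sum-cong (λ x → when-split S u Su x (deg S x)) ⟩
      sumFin (λ x → when ((S ⊖ u) x) (deg S x) + when (x == u) (deg S x))
    ≡⟨ sum-+ {n} _ _ ⟩
      sumFin (λ x → when ((S ⊖ u) x) (deg S x)) + sumFin (λ x → when (x == u) (deg S x))
    ≡⟨ cong₂ _+_ rest (sum-point u (deg S)) ⟩
      (degSum (S ⊖ u) + deg S u) + deg S u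
    ≡⟨ +-assoc (degSum (S ⊖ u)) (deg S u) (deg S u) ⟩
      degSum (S ⊖ u) + (deg S u + deg S u) ∎
    where
      open ≡-Reasoning
      S′ = S ⊖ u
      rest : sumFin (λ x → when (S′ x) (deg S x)) ≡ degSum S′ + deg S u
      rest = begin
          sumFin (λ x → when (S′ x) (deg S x))
        ≡⟨ sum-cong (λ x → trans (cong (when (S′ x)) (deg-⊖ S u Su x)) (when-+ (S′ x) _ _)) ⟩
          sumFin (λ x → when (S′ x) (deg S′ x) + when (S′ x) (when (F x u) 1))
        ≡⟨ sum-+ {n} _ _ ⟩
          degSum S′ + sumFin (λ x → when (S′ x) (when (F x u) 1))
        ≡⟨ cong (degSum S′ +_) (sum-cong (λ x →
             trans (when-∧ (S′ x) (F x u) 1) (cong (λ b → when (S′ x ∧ b) 1) (F-sym x u)))) ⟩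
          degSum S′ + deg S′ u
        ≡⟨ cong (degSum S′ +_) (≡sym (deg-⊖-self S u Su)) ⟩
          degSum S′ + deg S u ∎

  -- The partners of u in S: the members of S other than u that are not
  -- F-adjacent to u, i.e. the possible partners of u once F is deleted.
  Partner : VSet → Fin n → Fin n → Set
  Partner S u y = (S y ≡ true) × ((y == u) ≡ false) × (F u y ≡ false)

  partners : VSet → Fin n → VSet
  partners S u y = S y ∧ (not (y == u) ∧ not (F u y))

  partner? : ∀ S u → Dec (∃ (Partner S u))
  partner? S u = any? (λ y → (S y ≟ᵇ true) ×-dec ((y == u) ≟ᵇ false) ×-dec (F u y ≟ᵇ false))

  Dominates : VSet → Fin n → Set
  Dominates S u = ∀ y → S y ≡ true → (y == u) ≡ false → F u y ≡ true

  no-partner⇒dominates : ∀ S u → ¬ ∃ (Partner S u) → Dominates S u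
  no-partner⇒dominates S u none y Sy yu with F u y in Fuy
  ... | true  = refl
  ... | false = ⊥-elim (none (y , Sy , yu , Fuy))

  deg-dominating : ∀ S u → Dominates S u → deg S u ≡ size (S ⊖ u)
  deg-dominating S u dom = sum-cong pointwise
    where
      pointwise : ∀ y → when (S y ∧ F u y) 1 ≡ when ((S ⊖ u) y) 1
      pointwise y with S y in Sy | y == u in yu
      ... | false | _     = refl
      ... | true  | false rewrite dom y Sy yu = refl
      ... | true  | true  = cong (λ b → when b 1) (trans (cong (F u) (==⇒≡ yu)) (F-irrefl u))

  -- Counting around a vertex u ∈ S of maximum degree d: S consists of u, its
  -- d F-neighbours and its partners, so with r partners of total degree s,
  --   r + d + 1 = |S|,  degSum S ≤ d + d·d + s,  s ≤ r·d,
  -- and 2s ≤ r·Q as soon as every partner x has 2·deg S x ≤ Q.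
  partnerCount partnerDeg : VSet → Fin n → ℕ
  partnerCount S u = size (partners S u)
  partnerDeg S u = sumFin (λ x → when (partners S u x) (deg S x))

  IsMaxDegree : VSet → Fin n → Set
  IsMaxDegree S u = ∀ x → S x ≡ true → deg S x ≤ deg S u

  size-around : ∀ S u → S u ≡ true → partnerCount S u + deg S u + 1 ≡ size S
  size-around S u Su = ≡sym (begin
      size S
    ≡⟨ sum-cong pointwise ⟩
      sumFin (λ x → (when (x == u) 1 + when (S x ∧ F u x) 1) + when (partners S u x) 1)
    ≡⟨ trans (sum-+ {n} _ _) (cong (_+ r) (trans (sum-+ {n} _ _) (cong (_+ d) (sum-point u (λ _ → 1))))) ⟩
      (1 + d) + r
    ≡⟨ +-comm (1 + d) r ⟩
      r + (1 + d)
    ≡⟨ cong (r +_) (+-comm 1 d) ⟩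
      r + (d + 1)
    ≡⟨ ≡sym (+-assoc r d 1) ⟩
      r + d + 1 ∎)
    where
      open ≡-Reasoning
      r = partnerCount S u
      d = deg S u
      pointwise : ∀ x → when (S x) 1 ≡ (when (x == u) 1 + when (S x ∧ F u x) 1) + when (partners S u x) 1
      pointwise x with S x in Sx | x == u in xu | F u x in Fux
      ... | false | false | _     = refl
      ... | false | true  | _     = ⊥-elim (false≢true (trans (≡sym Sx) (trans (cong S (==⇒≡ xu)) Su)))
      ... | true  | true  | true  = ⊥-elim (false≢true (trans (≡sym (F-irrefl u)) (trans (cong (F u) (≡sym (==⇒≡ xu))) Fux)))
      ... | true  | true  | false = refl
      ... | true  | false | true  = refl
      ... | true  | false | false = refl

  degSum-around : ∀ S u → IsMaxDegree S u → degSum S ≤ deg S u + deg S u * deg S u + partnerDeg S u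
  degSum-around S u max = ≤-trans (sum-mono pointwise) (≤-reflexive (trans (sum-+ {n} _ _) (cong (_+ partnerDeg S u)
      (trans (sum-+ {n} _ _) (cong₂ _+_ (sum-point u (λ _ → d)) (sum-when (λ x → S x ∧ F u x) d))))))
    where
      d = deg S u
      pointwise : ∀ x → when (S x) (deg S x) ≤ (when (x == u) d + when (S x ∧ F u x) d) + when (partners S u x) (deg S x)
      pointwise x with S x in Sx | x == u in xu | F u x
      ... | false | _     | _     = z≤n
      ... | true  | true  | _     = ≤-trans (≤-reflexive (cong (deg S) (==⇒≡ xu))) (≤-trans (m≤m+n d _) (m≤m+n _ _))
      ... | true  | false | true  = ≤-trans (max x Sx) (m≤m+n d 0)
      ... | true  | false | false = ≤-refl

  partnerDeg-≤ : ∀ S u → IsMaxDegree S u → partnerDeg S u ≤ partnerCount S u * deg S u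
  partnerDeg-≤ S u max = ≤-trans (sum-mono pointwise)
    (≤-reflexive (trans (sum-when (partners S u) (deg S u)) (*-comm (deg S u) _)))
    where
      pointwise : ∀ x → when (partners S u x) (deg S x) ≤ when (partners S u x) (deg S u)
      pointwise x with S x in Sx | x == u | F u x
      ... | false | _     | _     = z≤n
      ... | true  | true  | _     = z≤n
      ... | true  | false | true  = z≤n
      ... | true  | false | false = max x Sx

  partnerDeg-≤-bound : ∀ S u Q → (∀ x → Partner S u x → 2 * deg S x ≤ Q) →
                       2 * partnerDeg S u ≤ partnerCount S u * Q
  partnerDeg-≤-bound S u Q bound = ≤-trans (≤-reflexive (≡sym (sum-* {n} 2 _)))
    (≤-trans (sum-mono pointwise) (≤-reflexive (trans (sum-when (partners S u) Q) (*-comm Q _))))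
    where
      pointwise : ∀ x → 2 * when (partners S u x) (deg S x) ≤ when (partners S u x) Q
      pointwise x with S x in Sx | x == u in xu | F u x in Fux
      ... | false | _     | _     = z≤n
      ... | true  | true  | _     = z≤n
      ... | true  | false | true  = z≤n
      ... | true  | false | false = bound x (Sx , xu , Fux)

-- The number of deleted edges tolerated on 2k + 1 vertices: for k ≥ 4 it is
-- 4k − 2 = 2(2k + 1) − 4, one less than the size of a two-vertex star.
capacity : ℕ → ℕ
capacity 0 = 0
capacity 1 = 2
capacity 2 = 5
capacity 3 = 9
capacity (suc (suc (suc (suc j)))) = 14 + 4 * j

-- The numerical core of the good-pair argument (see GoodPairs below), for a
-- set S of 2k + 3 vertices whose deleted edges have degree sum f.
--   A: a vertex u of maximum degree d has r partners of degree sum s.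
--   B: u dominates S, and in S ⊖ u (degree sum f′ = f − 2(2k + 2)) a vertex
--      w of maximum degree d has r partners of degree sum s.
--   C: u dominates S and w dominates S ⊖ u.
ImpossibleA : ℕ → Set
ImpossibleA k = ∀ f d s r → f ≤ 2 * capacity (suc k) → 2 * capacity k + 2 * d < f →
  f ≤ d + d * d + s → s ≤ r * d → 2 * s ≤ r * (f ∸ (2 * capacity k + 2 * d + 1)) →
  r + d + 1 ≡ 2 * suc k + 1 → ⊥

ImpossibleB : ℕ → Set
ImpossibleB k = ∀ f f′ d s r → f ≡ f′ + (2 * suc k + 2 * suc k) → f ≤ 2 * capacity (suc k) →
  2 * capacity k + 2 * (suc d + 1) < f → f′ ≤ d + d * d + s → s ≤ r * d →
  2 * s ≤ r * (f ∸ (2 * capacity k + 2 * (suc d + 1) + 1)) → r + d + 1 ≡ 2 * suc k → ⊥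

ImpossibleC : ℕ → Set
ImpossibleC k = ∀ f → ((2 * k + 1) + (2 * k + 1)) + (2 * suc k + 2 * suc k) ≤ f →
  f ≤ 2 * capacity (suc k) → ⊥

-- For k ≤ 3 the hypotheses of A and B bound f and d, determine r, and bound
-- s from below, so a finite Boolean search over (f , d) refutes them.
allUpTo : ℕ → (ℕ → Bool) → Bool
allUpTo zero    P = P zero
allUpTo (suc B) P = P (suc B) ∧ allUpTo B P

allUpTo-sound : ∀ B P → allUpTo B P ≡ true → ∀ x → x ≤ B → P x ≡ true
allUpTo-sound zero    P e zero z≤n = e
allUpTo-sound (suc B) P e x x≤B with m≤n⇒m<n∨m≡n x≤B
... | inj₁ (s≤s x≤B′) = allUpTo-sound B P (∧-right e) x x≤B′
... | inj₂ refl      = ∧-left e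

≤⇒≤ᵇ-true : ∀ {m n} → m ≤ n → (m ≤ᵇ n) ≡ true
≤⇒≤ᵇ-true m≤n = Equivalence.to T-≡ (≤⇒≤ᵇ m≤n)

∧-intro : ∀ {a b} → a ≡ true → b ≡ true → a ∧ b ≡ true
∧-intro refl e = e

not-true : ∀ {b} → not b ≡ true → b ≡ true → ⊥
not-true {true}  () _
not-true {false} _ ()

r-from-size : ∀ r d m → r + d + 1 ≡ m → r ≡ m ∸ (d + 1)
r-from-size r d m h = trans (≡sym (m+n∸n≡m r (d + 1))) (cong (_∸ (d + 1)) (trans (≡sym (+-assoc r d 1)) h))

d-from-size : ∀ r d m → r + d + 1 ≡ m → d ≤ m
d-from-size r d m h = ≤-trans (m≤n+m d r) (≤-trans (m≤m+n (r + d) 1) (≤-reflexive h))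

-- The constraints of A with r = 2k + 3 − (d + 1) and s replaced by its lower
-- bound f − (d + d·d); similarly for B.
counterexampleA : ℕ → ℕ → ℕ → Bool
counterexampleA k f d = (f ≤ᵇ 2 * capacity (suc k)) ∧ ((suc (2 * capacity k + 2 * d) ≤ᵇ f) ∧
  (((f ∸ (d + d * d)) ≤ᵇ ((2 * suc k + 1) ∸ (d + 1)) * d) ∧
   ((2 * (f ∸ (d + d * d))) ≤ᵇ ((2 * suc k + 1) ∸ (d + 1)) * (f ∸ (2 * capacity k + 2 * d + 1)))))

impossibleA-search : ∀ k →
  allUpTo (2 * capacity (suc k)) (λ f → allUpTo (2 * suc k + 1) (λ d → not (counterexampleA k f d))) ≡ true →
  ImpossibleA k
impossibleA-search k search f d s r f≤ f> f≤s s≤ 2s≤ count≡ =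
  not-true (allUpTo-sound _ _ (allUpTo-sound _ _ search f f≤) d (d-from-size r d _ count≡)) found
  where
    r≡ = r-from-size r d _ count≡
    s≥ : f ∸ (d + d * d) ≤ s
    s≥ = m≤n+o⇒m∸n≤o f (d + d * d) f≤s
    found : counterexampleA k f d ≡ true
    found = ∧-intro (≤⇒≤ᵇ-true f≤) (∧-intro (≤⇒≤ᵇ-true f>)
      (∧-intro (≤⇒≤ᵇ-true (subst (λ z → _ ≤ z * d) r≡ (≤-trans s≥ s≤)))
               (≤⇒≤ᵇ-true (subst (λ z → _ ≤ z * _) r≡ (≤-trans (*-monoʳ-≤ 2 s≥) 2s≤)))))

counterexampleB : ℕ → ℕ → ℕ → Bool
counterexampleB k f d = (f ≤ᵇ 2 * capacity (suc k)) ∧ ((suc (2 * capacity k + 2 * (suc d + 1)) ≤ᵇ f) ∧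
  ((((f ∸ (2 * suc k + 2 * suc k)) ∸ (d + d * d)) ≤ᵇ ((2 * suc k) ∸ (d + 1)) * d) ∧
   ((2 * ((f ∸ (2 * suc k + 2 * suc k)) ∸ (d + d * d))) ≤ᵇ
      ((2 * suc k) ∸ (d + 1)) * (f ∸ (2 * capacity k + 2 * (suc d + 1) + 1)))))

impossibleB-search : ∀ k →
  allUpTo (2 * capacity (suc k)) (λ f → allUpTo (2 * suc k) (λ d → not (counterexampleB k f d))) ≡ true →
  ImpossibleB k
impossibleB-search k search f f′ d s r f≡ f≤ f> f′≤s s≤ 2s≤ count≡ =
  not-true (allUpTo-sound _ _ (allUpTo-sound _ _ search f f≤) d (d-from-size r d _ count≡)) found
  where
    r≡ = r-from-size r d _ count≡
    f′≡ : f′ ≡ f ∸ (2 * suc k + 2 * suc k)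
    f′≡ = trans (≡sym (m+n∸n≡m f′ (2 * suc k + 2 * suc k))) (cong (_∸ (2 * suc k + 2 * suc k)) (≡sym f≡))
    s≥ : (f ∸ (2 * suc k + 2 * suc k)) ∸ (d + d * d) ≤ s
    s≥ = m≤n+o⇒m∸n≤o _ (d + d * d) (subst (_≤ _) f′≡ f′≤s)
    found : counterexampleB k f d ≡ true
    found = ∧-intro (≤⇒≤ᵇ-true f≤) (∧-intro (≤⇒≤ᵇ-true f>)
      (∧-intro (≤⇒≤ᵇ-true (subst (λ z → _ ≤ z * d) r≡ (≤-trans s≥ s≤)))
               (≤⇒≤ᵇ-true (subst (λ z → _ ≤ z * _) r≡ (≤-trans (*-monoʳ-≤ 2 s≥) 2s≤)))))

-- For k ≥ 4 the bound f ≤ d + d·d + s ≤ d·(r + d + 1) alone contradicts the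
-- lower bound on f when d is small, and the capacity bound when d is large.
degSum-≤-around : ∀ d r s f → f ≤ d + d * d + s → s ≤ r * d → f ≤ d * (r + d + 1)
degSum-≤-around d r s f f≤ s≤ = ≤-trans f≤ (≤-trans (+-monoʳ-≤ (d + d * d) s≤) (≤-reflexive (expand d r)))
  where expand : ∀ d r → d + d * d + r * d ≡ d * (r + d + 1)
        expand = solve-∀

squeeze : ∀ {f X Y} → f ≤ X → X ≤ Y → Y < f → ⊥
squeeze f≤X X≤Y Y<f = <⇒≱ Y<f (≤-trans f≤X X≤Y)

≤-by : ∀ {a b} c → a + c ≡ b → a ≤ b
≤-by {a} c e = ≤-trans (m≤m+n a c) (≤-reflexive e)

impossibleA-large : ∀ j → ImpossibleA (4 + j)
impossibleA-large j f d s r f≤ f> f≤s s≤ _ count≡ = by-degree d f> f≤d·n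
  where
    f≤d·n : f ≤ d * (2 * (5 + j) + 1)
    f≤d·n = subst (λ z → f ≤ d * z) count≡ (degSum-≤-around d r s f f≤s s≤)
    by-degree : ∀ d → 2 * capacity (4 + j) + 2 * d < f → f ≤ d * (2 * (5 + j) + 1) → ⊥
    by-degree 0 f> f≤ = squeeze f≤ z≤n f>
    by-degree 1 f> f≤ = squeeze f≤ (≤-by (19 + 6 * j) (e j)) f>
      where e : ∀ j → 1 * (2 * (5 + j) + 1) + (19 + 6 * j) ≡ 2 * (14 + 4 * j) + 2 * 1
            e = solve-∀
    by-degree 2 f> f≤ = squeeze f≤ (≤-by (10 + 4 * j) (e j)) f>
      where e : ∀ j → 2 * (2 * (5 + j) + 1) + (10 + 4 * j) ≡ 2 * (14 + 4 * j) + 2 * 2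
            e = solve-∀
    by-degree 3 f> f≤ = squeeze f≤ (≤-by (1 + 2 * j) (e j)) f>
      where e : ∀ j → 3 * (2 * (5 + j) + 1) + (1 + 2 * j) ≡ 2 * (14 + 4 * j) + 2 * 3
            e = solve-∀
    by-degree (suc (suc (suc (suc e′)))) f> _ = squeeze f≤ (≤-by (2 * e′) (e j e′)) f>
      where e : ∀ j e′ → 2 * (14 + 4 * (1 + j)) + 2 * e′ ≡ 2 * (14 + 4 * j) + 2 * (4 + e′)
            e = solve-∀

impossibleB-large : ∀ j → ImpossibleB (4 + j)
impossibleB-large j f f′ d s r f≡ f≤ f> f′≤s s≤ _ count≡ = by-degree d f> f′≤d·n
  where
    f′≤d·n : f′ ≤ d * (2 * (5 + j))
    f′≤d·n = subst (λ z → f′ ≤ d * z) count≡ (degSum-≤-around d r s f′ f′≤s s≤)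
    c = 2 * (5 + j) + 2 * (5 + j)
    lift : ∀ {X} → f′ ≤ X → f ≤ X + c
    lift {X} f′≤ = subst (_≤ X + c) (≡sym f≡) (+-monoˡ-≤ c f′≤)
    by-degree : ∀ d → 2 * capacity (4 + j) + 2 * (suc d + 1) < f → f′ ≤ d * (2 * (5 + j)) → ⊥
    by-degree 0 f> f′≤ = squeeze (lift f′≤) (≤-by (12 + 4 * j) (e j)) f>
      where e : ∀ j → 0 + (2 * (5 + j) + 2 * (5 + j)) + (12 + 4 * j) ≡ 2 * (14 + 4 * j) + 2 * (1 + 1)
            e = solve-∀
    by-degree 1 f> f′≤ = squeeze (lift f′≤) (≤-by (4 + 2 * j) (e j)) f>
      where e : ∀ j → 1 * (2 * (5 + j)) + (2 * (5 + j) + 2 * (5 + j)) + (4 + 2 * j) ≡ 2 * (14 + 4 * j) + 2 * (2 + 1)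
            e = solve-∀
    by-degree (suc (suc e′)) f> _ = squeeze f≤ (≤-by (2 * e′) (e j e′)) f>
      where e : ∀ j e′ → 2 * (14 + 4 * (1 + j)) + 2 * e′ ≡ 2 * (14 + 4 * j) + 2 * (3 + e′ + 1)
            e = solve-∀

impossibleA : ∀ k → ImpossibleA k
impossibleA 0 = impossibleA-search 0 refl
impossibleA 1 = impossibleA-search 1 refl
impossibleA 2 = impossibleA-search 2 refl
impossibleA 3 = impossibleA-search 3 refl
impossibleA (suc (suc (suc (suc j)))) = impossibleA-large j

impossibleB : ∀ k → ImpossibleB k
impossibleB 0 = impossibleB-search 0 refl
impossibleB 1 = impossibleB-search 1 refl
impossibleB 2 = impossibleB-search 2 refl
impossibleB 3 = impossibleB-search 3 refl
impossibleB (suc (suc (suc (suc j)))) = impossibleB-large j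

-- For k ≤ 3 the two bounds of C are numerals, and ≤ᵇ refutes them by evaluation.
impossibleC : ∀ k → ImpossibleC k
impossibleC 0 f lo hi = ≤⇒≤ᵇ (≤-trans lo hi)
impossibleC 1 f lo hi = ≤⇒≤ᵇ (≤-trans lo hi)
impossibleC 2 f lo hi = ≤⇒≤ᵇ (≤-trans lo hi)
impossibleC 3 f lo hi = ≤⇒≤ᵇ (≤-trans lo hi)
impossibleC (suc (suc (suc (suc j)))) f lo hi = <⇒≱ (≤-trans (≤-by 1 (e j)) lo) hi
  where e : ∀ j → suc (2 * (14 + 4 * (1 + j))) + 1 ≡ ((2 * (4 + j) + 1) + (2 * (4 + j) + 1)) + (2 * (5 + j) + 2 * (5 + j))
        e = solve-∀

half-gap : ∀ a b c f → a + 2 * (b + c) < f → 2 * c ≤ f ∸ (a + 2 * b + 1)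
half-gap a b c f h = ≤-trans (≤-reflexive (≡sym (m+n∸m≡n (a + 2 * b + 1) (2 * c))))
                       (∸-monoˡ-≤ (a + 2 * b + 1) (≤-trans (≤-reflexive (e a b c)) h))
  where e : ∀ a b c → a + 2 * b + 1 + 2 * c ≡ 1 + (a + 2 * (b + c))
        e = solve-∀

-- The key step of the induction: on 2k + 3 vertices with at most
-- capacity (k + 1) deleted edges there is a good pair, a surviving edge uv
-- whose two endpoints carry enough deleted edges that removing them leaves at
-- most capacity k.  If there were none, every surviving edge uv would have
-- 2·capacity k + 2(deg u + deg v) < degSum S; applying this at a vertex of
-- maximum degree (and, if it dominates, at one of maximum degree in the
-- rest) yields the numerical situations excluded by impossibleA/B/C.
module GoodPairs {n : ℕ} (F : Fin n → Fin n → Bool)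
    (F-sym : ∀ i j → F i j ≡ F j i) (F-irrefl : ∀ i → F i i ≡ false) where
  open RestrictedDegrees F F-sym F-irrefl

  GoodPair : ℕ → VSet → Fin n → Fin n → Set
  GoodPair k S u v = (S u ≡ true) × Partner S u v × (degSum S ≤ 2 * capacity k + 2 * (deg S u + deg S v))

  goodPair? : ∀ k S u v → Dec (GoodPair k S u v)
  goodPair? k S u v = (S u ≟ᵇ true) ×-dec ((S v ≟ᵇ true) ×-dec ((v == u) ≟ᵇ false) ×-dec (F u v ≟ᵇ false))
                      ×-dec (degSum S ≤? 2 * capacity k + 2 * (deg S u + deg S v))

  NoGoodPair : ℕ → VSet → Set
  NoGoodPair k S = ∀ u v → S u ≡ true → Partner S u v → 2 * capacity k + 2 * (deg S u + deg S v) < degSum S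

  Partner-⊖ : ∀ S u w y → Partner (S ⊖ u) w y → Partner S w y
  Partner-⊖ S u w y (Sy , yw , Fwy) = ∧-left Sy , yw , Fwy

  partnerCase : ∀ k S → size S ≡ 2 * suc k + 1 → degSum S ≤ 2 * capacity (suc k) → NoGoodPair k S →
    ∀ u → S u ≡ true → IsMaxDegree S u → ∀ y → Partner S u y → ⊥
  partnerCase k S sizeS bound none u Su max y uy =
    impossibleA k (degSum S) d (partnerDeg S u) (partnerCount S u) bound gap
      (degSum-around S u max) (partnerDeg-≤ S u max) (partnerDeg-≤-bound S u _ partner-bound)
      (trans (size-around S u Su) sizeS)
    where
      d = deg S u
      gap : 2 * capacity k + 2 * d < degSum S
      gap = ≤-<-trans (+-monoʳ-≤ (2 * capacity k) (*-monoʳ-≤ 2 (m≤m+n d (deg S y)))) (none u y Su uy)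
      partner-bound : ∀ x → Partner S u x → 2 * deg S x ≤ degSum S ∸ (2 * capacity k + 2 * d + 1)
      partner-bound x ux = half-gap (2 * capacity k) d (deg S x) (degSum S) (none u x Su ux)

  deg-⊖-dominating : ∀ S u → S u ≡ true → Dominates S u → ∀ x → (S ⊖ u) x ≡ true → deg S x ≡ deg (S ⊖ u) x + 1
  deg-⊖-dominating S u Su dom x e = trans (deg-⊖ S u Su x)
    (cong (λ b → deg (S ⊖ u) x + when b 1) (trans (F-sym x u) (dom x (∧-left e) (⊖-≢ S u x e))))

  degSum-⊖-dominating : ∀ k S u → S u ≡ true → Dominates S u → size S ≡ 2 * suc k + 1 →
                        degSum S ≡ degSum (S ⊖ u) + (2 * suc k + 2 * suc k)
  degSum-⊖-dominating k S u Su dom sizeS = trans (degSum-⊖ S u Su)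
    (cong (λ z → degSum (S ⊖ u) + (z + z)) (trans (deg-dominating S u dom) (size-⊖-pred S u (2 * suc k) Su sizeS)))

  -- Case B: u dominates S and a vertex w of maximum degree in S ⊖ u has a
  -- partner y; degrees in S exceed those in S ⊖ u by one.
  dominatedPartnerCase : ∀ k S → size S ≡ 2 * suc k + 1 → degSum S ≤ 2 * capacity (suc k) → NoGoodPair k S →
    ∀ u → S u ≡ true → Dominates S u →
    ∀ w → (S ⊖ u) w ≡ true → IsMaxDegree (S ⊖ u) w → ∀ y → Partner (S ⊖ u) w y → ⊥
  dominatedPartnerCase k S sizeS bound none u Su dom w Sw max y wy =
    impossibleB k (degSum S) (degSum S′) d (partnerDeg S′ w) (partnerCount S′ w)
      (degSum-⊖-dominating k S u Su dom sizeS) bound gap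
      (degSum-around S′ w max) (partnerDeg-≤ S′ w max) (partnerDeg-≤-bound S′ w _ partner-bound)
      (trans (size-around S′ w Sw) (size-⊖-pred S u (2 * suc k) Su sizeS))
    where
      S′ = S ⊖ u
      d = deg S′ w
      a = 2 * capacity k
      shift : ∀ x → S′ x ≡ true → a + 2 * (deg S w + deg S x) ≡ a + 2 * ((suc d + 1) + deg S′ x)
      shift x S′x = trans (cong₂ (λ p q → a + 2 * (p + q)) (deg-⊖-dominating S u Su dom w Sw)
                                                         (deg-⊖-dominating S u Su dom x S′x))
                          (e a d (deg S′ x))
        where e : ∀ a d x → a + 2 * ((d + 1) + (x + 1)) ≡ a + 2 * ((suc d + 1) + x)
              e = solve-∀
      none′ : ∀ x → Partner S′ w x → a + 2 * ((suc d + 1) + deg S′ x) < degSum S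
      none′ x wx = subst (_< degSum S) (shift x (proj₁ wx)) (none w x (∧-left Sw) (Partner-⊖ S u w x wx))
      gap : a + 2 * (suc d + 1) < degSum S
      gap = ≤-<-trans (+-monoʳ-≤ a (*-monoʳ-≤ 2 (m≤m+n (suc d + 1) (deg S′ y)))) (none′ y wy)
      partner-bound : ∀ x → Partner S′ w x → 2 * deg S′ x ≤ degSum S ∸ (a + 2 * (suc d + 1) + 1)
      partner-bound x wx = half-gap a (suc d + 1) (deg S′ x) (degSum S) (none′ x wx)

  -- Case C: u dominates S and w dominates S ⊖ u; then u and w alone
  -- contribute 2(2k + 2) + 2(2k + 1) to the degree sum, which is too much.
  doublyDominatedCase : ∀ k S → size S ≡ 2 * suc k + 1 → degSum S ≤ 2 * capacity (suc k) →
    ∀ u → S u ≡ true → Dominates S u → ∀ w → (S ⊖ u) w ≡ true → Dominates (S ⊖ u) w → ⊥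
  doublyDominatedCase k S sizeS bound u Su dom w Sw dom′ = impossibleC k (degSum S) lower bound
    where
      S′ = S ⊖ u
      size′ : size S′ ≡ 2 * k + 1 + 1
      size′ = trans (size-⊖-pred S u (2 * suc k) Su sizeS) (e k)
        where e : ∀ k → 2 * suc k ≡ 2 * k + 1 + 1
              e = solve-∀
      deg-w : deg S′ w ≡ 2 * k + 1
      deg-w = trans (deg-dominating S′ w dom′) (size-⊖-pred S′ w (2 * k + 1) Sw size′)
      lower : ((2 * k + 1) + (2 * k + 1)) + (2 * suc k + 2 * suc k) ≤ degSum S
      lower = ≤-trans (+-monoˡ-≤ (2 * suc k + 2 * suc k)
                (≤-trans (≤-reflexive (cong (λ z → z + z) (≡sym deg-w)))
                  (≤-trans (m≤n+m _ (degSum (S′ ⊖ w))) (≤-reflexive (≡sym (degSum-⊖ S′ w Sw))))))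
                (≤-reflexive (≡sym (degSum-⊖-dominating k S u Su dom sizeS)))

  dominatedCase : ∀ k S → size S ≡ 2 * suc k + 1 → degSum S ≤ 2 * capacity (suc k) → NoGoodPair k S →
    ∀ u → S u ≡ true → Dominates S u → ⊥
  dominatedCase k S sizeS bound none u Su dom = split (partner? S′ w)
    where
      S′ = S ⊖ u
      size′ : size S′ ≡ suc (2 * k + 1)
      size′ = trans (size-⊖-pred S u (2 * suc k) Su sizeS) (e k)
        where e : ∀ k → 2 * suc k ≡ suc (2 * k + 1)
              e = solve-∀
      inhabitant = nonempty S′ (2 * k + 1) size′
      maximiser = argmax S′ (deg S′) (proj₁ inhabitant) (proj₂ inhabitant)
      w = proj₁ maximiser
      S′w = proj₁ (proj₂ maximiser)
      split : Dec (∃ (Partner S′ w)) → ⊥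
      split (yes (y , wy)) =
        dominatedPartnerCase k S sizeS bound none u Su dom w S′w (proj₂ (proj₂ maximiser)) y wy
      split (no noPartner) =
        doublyDominatedCase k S sizeS bound u Su dom w S′w (no-partner⇒dominates S′ w noPartner)

  goodPair : ∀ k S → size S ≡ 2 * suc k + 1 → degSum S ≤ 2 * capacity (suc k) →
             Σ (Fin n) λ u → Σ (Fin n) λ v → GoodPair k S u v
  goodPair k S sizeS bound with any? (λ u → any? (λ v → goodPair? k S u v))
  ... | yes found    = found
  ... | no  notFound = split (partner? S u)
    where
      none : NoGoodPair k S
      none u v Su uv = ≰⇒> (λ le → notFound (u , v , Su , uv , le))
      inhabitant = nonempty S (2 * suc k) (trans sizeS (+-comm _ 1))
      maximiser = argmax S (deg S) (proj₁ inhabitant) (proj₂ inhabitant)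
      u = proj₁ maximiser
      Su = proj₁ (proj₂ maximiser)
      split : Dec (∃ (Partner S u)) → Σ (Fin n) λ u → Σ (Fin n) λ v → GoodPair k S u v
      split (yes (y , uy)) = ⊥-elim (partnerCase k S sizeS bound none u Su (proj₂ (proj₂ maximiser)) y uy)
      split (no noPartner) = ⊥-elim (dominatedCase k S sizeS bound none u Su (no-partner⇒dominates S u noPartner))

-- Induction on k: from 2k + 3 vertices remove a good pair u, v,
-- match the remaining 2k + 1 vertices and add the edge uv.
module AlmostPerfect {n : ℕ} (F : Fin n → Fin n → Bool)
    (F-sym : ∀ i j → F i j ≡ F j i) (F-irrefl : ∀ i → F i i ≡ false) where
  open RestrictedDegrees F F-sym F-irrefl
  open GoodPairs F F-sym F-irrefl

  matchDeg : (Fin n → Fin n → Bool) → Fin n → ℕ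
  matchDeg M x = sumFin (λ y → when (M x y) 1)

  record AlmostPerfectMatching (S : VSet) : Set where
    field
      M        : Fin n → Fin n → Bool
      M-sym    : ∀ x y → M x y ≡ M y x
      M-edges  : ∀ x y → M x y ≡ true → (S x ≡ true) × (S y ≡ true) × ((x == y) ≡ false) × (F x y ≡ false)
      missed   : Fin n
      S-missed : S missed ≡ true
      deg-missed : matchDeg M missed ≡ 0
      deg-other  : ∀ x → (x == missed) ≡ false → matchDeg M x ≡ when (S x) 1

  singleton : ∀ S → size S ≡ 1 → AlmostPerfectMatching S
  singleton S sizeS = record
    { M = λ _ _ → false ; M-sym = λ _ _ → refl ; M-edges = λ _ _ () ; missed = w ; S-missed = Sw
    ; deg-missed = sum-zero n ; deg-other = others }
    where
      w = proj₁ (nonempty S 0 sizeS)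
      Sw = proj₂ (nonempty S 0 sizeS)
      others : ∀ x → (x == w) ≡ false → sumFin {n} (λ _ → 0) ≡ when (S x) 1
      others x xw with S x in Sx
      ... | false = sum-zero n
      ... | true  = ⊥-elim (1+n≰n (≤-trans (+-monoˡ-≤ 1 (size-≥1 (S ⊖ w) x (⊖-keeps S w x Sx xw)))
                      (≤-reflexive (trans (≡sym (size-⊖ S w Sw)) sizeS))))

  Edge : Fin n → Fin n → Fin n → Fin n → Bool
  Edge u v x y = (x == u ∧ y == v) ∨ (x == v ∧ y == u)

  Edge-sym : ∀ u v x y → Edge u v x y ≡ Edge u v y x
  Edge-sym u v x y = trans (∨-comm (x == u ∧ y == v) _) (cong₂ _∨_ (∧-comm (x == v) _) (∧-comm (x == u) _))

  Edge-ends : ∀ u v x y → Edge u v x y ≡ true → ((x ≡ u) × (y ≡ v)) ⊎ ((x ≡ v) × (y ≡ u))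
  Edge-ends u v x y e with x == u in a | y == v in b | x == v in c | y == u in d
  ... | true  | true  | _     | _     = inj₁ (==⇒≡ a , ==⇒≡ b)
  ... | true  | false | true  | true  = inj₂ (==⇒≡ c , ==⇒≡ d)
  ... | false | _     | true  | true  = inj₂ (==⇒≡ c , ==⇒≡ d)
  ... | true  | false | true  | false = ⊥-elim (false≢true e)
  ... | true  | false | false | _     = ⊥-elim (false≢true e)
  ... | false | _     | true  | false = ⊥-elim (false≢true e)
  ... | false | _     | false | _     = ⊥-elim (false≢true e)

  matchDeg-Edge : ∀ u v → (u == v) ≡ false → ∀ x → matchDeg (Edge u v) x ≡ when (x == u) 1 + when (x == v) 1
  matchDeg-Edge u v uv x with x == u in a | x == v in c
  ... | true  | true  = ⊥-elim (==-false⇒≢ {i = u} {j = v} uv (trans (≡sym (==⇒≡ {i = x} a)) (==⇒≡ {i = x} c)))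
  ... | true  | false = trans (sum-cong (λ y → cong (λ b → when b 1) (∨-identityʳ (y == v)))) (sum-point v (λ _ → 1))
  ... | false | true  = sum-point u (λ _ → 1)
  ... | false | false = sum-zero n

  -- Removing a good pair leaves 2k + 1 vertices with degree sum at most
  -- 2·capacity k, since the pair carries deg u + deg v deleted edges.
  remove-goodPair : ∀ k S u v → size S ≡ 2 * suc k + 1 → GoodPair k S u v →
                    (size (S ⊖ u ⊖ v) ≡ 2 * k + 1) × (degSum (S ⊖ u ⊖ v) ≤ 2 * capacity k)
  remove-goodPair k S u v sizeS (Su , (Sv , vu , Fuv) , good) = size₂ , bound₂
    where
      S₁ = S ⊖ u
      S₁v = ⊖-keeps S u v Sv vu
      size₂ : size (S₁ ⊖ v) ≡ 2 * k + 1
      size₂ = +-cancelʳ-≡ 1 _ _ (+-cancelʳ-≡ 1 _ _ (trans (cong (_+ 1) (≡sym (size-⊖ S₁ v S₁v)))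
                (trans (≡sym (size-⊖ S u Su)) (trans sizeS (e k)))))
        where e : ∀ k → 2 * suc k + 1 ≡ (2 * k + 1) + 1 + 1
              e = solve-∀
      deg-v : deg S₁ v ≡ deg S v
      deg-v = ≡sym (trans (deg-⊖ S u Su v)
                (trans (cong (λ b → deg S₁ v + when b 1) (trans (F-sym v u) Fuv)) (+-identityʳ _)))
      degSum₂ : degSum S ≡ degSum (S₁ ⊖ v) + 2 * (deg S u + deg S v)
      degSum₂ = trans (degSum-⊖ S u Su) (trans (cong (_+ (deg S u + deg S u)) (trans (degSum-⊖ S₁ v S₁v)
                  (cong (λ z → degSum (S₁ ⊖ v) + (z + z)) deg-v))) (e (degSum (S₁ ⊖ v)) (deg S u) (deg S v)))
        where e : ∀ X du dv → X + (dv + dv) + (du + du) ≡ X + 2 * (du + dv)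
              e = solve-∀
      bound₂ : degSum (S₁ ⊖ v) ≤ 2 * capacity k
      bound₂ = +-cancelʳ-≤ (2 * (deg S u + deg S v)) _ _
                 (subst (_≤ 2 * capacity k + 2 * (deg S u + deg S v)) degSum₂ good)

  addEdge : ∀ S u v → S u ≡ true → Partner S u v → AlmostPerfectMatching (S ⊖ u ⊖ v) → AlmostPerfectMatching S
  addEdge S u v Su (Sv , vu , Fuv) R = record
    { M = M ; M-sym = M-sym ; M-edges = M-edges ; missed = R.missed ; S-missed = inS R.missed R.S-missed
    ; deg-missed = deg-missed ; deg-other = deg-other }
    where
      module R = AlmostPerfectMatching R
      uv = ==-false-comm v u vu
      S₁ = S ⊖ u
      S₂ = S₁ ⊖ v
      S₁v = ⊖-keeps S u v Sv vu
      inS : ∀ x → S₂ x ≡ true → S x ≡ true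
      inS x e = ∧-left (∧-left e)
      ≢u : ∀ x → S₂ x ≡ true → (x == u) ≡ false
      ≢u x e = ⊖-≢ S u x (∧-left e)
      ≢v : ∀ x → S₂ x ≡ true → (x == v) ≡ false
      ≢v x e = ⊖-≢ S₁ v x e
      M : Fin n → Fin n → Bool
      M x y = R.M x y ∨ Edge u v x y
      M-sym : ∀ x y → M x y ≡ M y x
      M-sym x y = cong₂ _∨_ (R.M-sym x y) (Edge-sym u v x y)
      M-edges : ∀ x y → M x y ≡ true → (S x ≡ true) × (S y ≡ true) × ((x == y) ≡ false) × (F x y ≡ false)
      M-edges x y e with ∨-cases {R.M x y} e
      ... | inj₁ r = let (Sx , Sy , xy , Fxy) = R.M-edges x y r in inS x Sx , inS y Sy , xy , Fxy
      ... | inj₂ p with Edge-ends u v x y p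
      ...   | inj₁ (refl , refl) = Su , Sv , uv , Fuv
      ...   | inj₂ (refl , refl) = Sv , Su , vu , trans (F-sym v u) Fuv
      -- the matched vertices of R avoid u and v, so R and uv are disjoint
      disjoint : ∀ x y → R.M x y ≡ true → Edge u v x y ≡ false
      disjoint x y r = cong₂ (λ p q → (p ∧ y == v) ∨ (q ∧ y == u)) (≢u x S₂x) (≢v x S₂x)
        where S₂x = proj₁ (R.M-edges x y r)
      matchDeg-M : ∀ x → matchDeg M x ≡ matchDeg R.M x + (when (x == u) 1 + when (x == v) 1)
      matchDeg-M x = trans (sum-cong (λ y → when-∨ (R.M x y) (Edge u v x y) (disjoint x y)))
                       (trans (sum-+ {n} _ _) (cong (matchDeg R.M x +_) (matchDeg-Edge u v uv x)))
      deg-missed : matchDeg M R.missed ≡ 0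
      deg-missed = trans (matchDeg-M R.missed) (cong₂ _+_ R.deg-missed
        (cong₂ (λ p q → when p 1 + when q 1) (≢u R.missed R.S-missed) (≢v R.missed R.S-missed)))
      deg-other : ∀ x → (x == R.missed) ≡ false → matchDeg M x ≡ when (S x) 1
      deg-other x x≢ = trans (matchDeg-M x) (trans (cong (_+ _) (R.deg-other x x≢)) (≡sym (begin
          when (S x) 1
        ≡⟨ when-split S u Su x 1 ⟩
          when (S₁ x) 1 + when (x == u) 1
        ≡⟨ cong (_+ when (x == u) 1) (when-split S₁ v S₁v x 1) ⟩
          when (S₂ x) 1 + when (x == v) 1 + when (x == u) 1
        ≡⟨ e (when (S₂ x) 1) _ _ ⟩
          when (S₂ x) 1 + (when (x == u) 1 + when (x == v) 1) ∎)))
        where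
          open ≡-Reasoning
          e : ∀ a b c → a + c + b ≡ a + (b + c)
          e = solve-∀

  almostPerfectMatching : ∀ k S → size S ≡ 2 * k + 1 → degSum S ≤ 2 * capacity k → AlmostPerfectMatching S
  almostPerfectMatching zero    S sizeS _     = singleton S sizeS
  almostPerfectMatching (suc k) S sizeS bound =
    let (u , v , good@(Su , uv , _)) = goodPair k S sizeS bound
        (size₂ , bound₂) = remove-goodPair k S u v sizeS good
    in addEdge S u v Su uv (almostPerfectMatching k (S ⊖ u ⊖ v) size₂ bound₂)

degreeSum : ∀ {n} → Graph n → ℕ
degreeSum F = sumFin (λ x → sumFin (λ y → when (adj F x y) 1))

handshake : ∀ {n} (F : Graph n) → 2 * edgeCount F ≡ degreeSum F
handshake {n} F = ≡sym (begin
    degreeSum F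
  ≡⟨ sum-cong (λ x → trans (sum-cong (split x)) (sum-+ {n} _ _)) ⟩
    sumFin (λ x → sumFin (λ y → below x y) + sumFin (λ y → above x y))
  ≡⟨ sum-+ {n} _ _ ⟩
    E + sumFin (λ x → sumFin (λ y → above x y))
  ≡⟨ cong (E +_) (trans (sum-swap above)
       (sum-cong (λ y → sum-cong (λ x → cong (λ b → when (b ∧ ⌊ x <? y ⌋) 1) (sym F x y))))) ⟩
    E + E
  ≡⟨ cong (E +_) (≡sym (+-identityʳ E)) ⟩
    2 * E
  ≡⟨ cong (2 *_) (≡sym (sum-cong (λ x → count-sum (λ y → adj F x y ∧ ⌊ y <? x ⌋)))) ⟩
    2 * edgeCount F ∎)
  where
    open ≡-Reasoning
    below above : Fin n → Fin n → ℕ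
    below x y = when (adj F x y ∧ ⌊ y <? x ⌋) 1
    above x y = when (adj F x y ∧ ⌊ x <? y ⌋) 1
    E = sumFin (λ x → sumFin (λ y → below x y))
    -- every edge xy has exactly one of y < x, x < y, since loops are absent
    split : ∀ x y → when (adj F x y) 1 ≡ below x y + above x y
    split x y with adj F x y in e
    ... | false = refl
    ... | true with y <? x | x <? y
    ...   | yes y<x | yes x<y = ⊥-elim (F<-asym y<x x<y)
    ...   | yes _   | no _    = refl
    ...   | no _    | yes _   = refl
    ...   | no y≮x  | no x≮y with F<-cmp x y
    ...     | tri< x<y _ _   = ⊥-elim (x≮y x<y)
    ...     | tri> _ _ y<x   = ⊥-elim (y≮x y<x)
    ...     | tri≈ _ refl _  = ⊥-elim (false≢true (trans (≡sym (irrefl F x)) e))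

-- A vertex with no edges cannot be covered by a matching; two distinct such
-- vertices rule out both perfect and almost-perfect matchings.
Isolated : ∀ {n} → Graph n → Fin n → Set
Isolated H i = ∀ y → adj H i y ≡ false

isolated-degree : ∀ {n} (H M : Graph n) → M ⊆ H → ∀ i → Isolated H i → degree M i ≡ 0
isolated-degree {n} H M M⊆H i iso = trans (count-sum (adj M i)) (trans (sum-cong pointwise) (sum-zero n))
  where pointwise : ∀ y → when (adj M i y) 1 ≡ 0
        pointwise y with adj M i y in e
        ... | false = refl
        ... | true  = ⊥-elim (false≢true (trans (≡sym (iso y)) (M⊆H i y e)))

noMatching : ∀ {n} (H : Graph n) i j → i ≢ j → Isolated H i → Isolated H j → NoPMNoAPM H
noMatching H i j i≢j iso-i iso-j = noPerfect , noAlmostPerfect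
  where
    uncovered : ∀ M → M ⊆ H → ∀ x → Isolated H x → degree M x ≢ 1
    uncovered M M⊆H x iso d≡1 = 0≢1+n (trans (≡sym (isolated-degree H M M⊆H x iso)) d≡1)
    noPerfect : ¬ (∃[ M ] IsPerfectMatching H M)
    noPerfect (M , M⊆H , deg≡1) = uncovered M M⊆H i iso-i (deg≡1 i)
    noAlmostPerfect : ¬ (∃[ M ] IsAlmostPerfectMatching H M)
    noAlmostPerfect (M , M⊆H , v , _ , deg≡1) with i ≟ v
    ... | yes refl = uncovered M M⊆H j iso-j (deg≡1 j (λ j≡i → i≢j (≡sym j≡i)))
    ... | no  i≢v  = uncovered M M⊆H i iso-i (deg≡1 i i≢v)

touches : ∀ {n} → Fin n → Fin n → Fin n → Fin n → Bool
touches i j x y = (x == i ∨ x == j) ∨ (y == i ∨ y == j)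

Star : ∀ {n} → Graph n → Fin n → Fin n → Graph n
adj (Star G i j) x y = adj G x y ∧ touches i j x y
sym (Star G i j) x y = cong₂ _∧_ (sym G x y) (∨-comm (x == i ∨ x == j) _)
irrefl (Star G i j) x = cong (_∧ touches i j x x) (irrefl G x)

Star⊆ : ∀ {n} (G : Graph n) i j → Star G i j ⊆ G
Star⊆ G i j x y = ∧-left

deleted : ∀ a t → t ≡ true → a ∧ not (a ∧ t) ≡ false
deleted true  t refl = refl
deleted false t _    = refl

touches-i : ∀ {n} (i j y : Fin n) → touches i j i y ≡ true
touches-i i j y = cong (λ b → (b ∨ i == j) ∨ (y == i ∨ y == j)) (==-refl i)

touches-j : ∀ {n} (i j y : Fin n) → touches i j j y ≡ true
touches-j i j y = cong (λ b → b ∨ (y == i ∨ y == j)) (trans (cong (j == i ∨_) (==-refl j)) (∨-zeroʳ (j == i)))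

Star-isolates-i : ∀ {n} (G : Graph n) i j → Isolated (G ∖ Star G i j) i
Star-isolates-i G i j y = deleted (adj G i y) _ (touches-i i j y)

Star-isolates-j : ∀ {n} (G : Graph n) i j → Isolated (G ∖ Star G i j) j
Star-isolates-j G i j y = deleted (adj G j y) _ (touches-j i j y)

2n∸3-≡ : ∀ p → 2 * (p + 1 + 1) ∸ 3 ≡ suc (p + p)
2n∸3-≡ p = trans (cong (_∸ 3) (e p)) (m+n∸m≡n 3 (suc (p + p)))
  where e : ∀ p → 2 * (p + 1 + 1) ≡ 3 + suc (p + p)
        e = solve-∀

-- Removing i and then j
-- from the full vertex set leaves p = n − 2 vertices spanning no star edge,
-- so the degree sum of the star is 2·deg j (in V ⊖ i) + 2·deg i (in V).
module StarDegrees {n : ℕ} (G : Graph n) (i j : Fin n) (i≢j : i ≢ j) where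
  open RestrictedDegrees (adj (Star G i j)) (sym (Star G i j)) (irrefl (Star G i j))

  V V⊖i rest : VSet
  V _  = true
  V⊖i  = V ⊖ i
  rest = V⊖i ⊖ j

  p : ℕ
  p = size rest

  j∈V⊖i : V⊖i j ≡ true
  j∈V⊖i = ⊖-keeps V i j refl (≢⇒==-false (λ j≡i → i≢j (≡sym j≡i)))

  size-V⊖i : size V⊖i ≡ p + 1
  size-V⊖i = size-⊖ V⊖i j j∈V⊖i

  n≡p+2 : n ≡ p + 1 + 1
  n≡p+2 = trans (≡sym (sum-ones n)) (trans (size-⊖ V i refl) (cong (_+ 1) size-V⊖i))

  2n∸3≡2p+1 : 2 * n ∸ 3 ≡ suc (p + p)
  2n∸3≡2p+1 = trans (cong (λ m → 2 * m ∸ 3) n≡p+2) (2n∸3-≡ p)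

  rest-degSum : degSum rest ≡ 0
  rest-degSum = trans (sum-cong pointwise) (sum-zero n)
    where
      away : ∀ x → rest x ≡ true → (x == i ∨ x == j) ≡ false
      away x e = cong₂ _∨_ (⊖-≢ V i x (∧-left e)) (⊖-≢ V⊖i j x e)
      pointwise : ∀ x → when (rest x) (deg rest x) ≡ 0
      pointwise x with rest x in rx
      ... | false = refl
      ... | true  = trans (sum-cong noEdge) (sum-zero n)
        where noEdge : ∀ y → when (rest y ∧ adj (Star G i j) x y) 1 ≡ 0
              noEdge y with rest y in ry
              ... | false = refl
              ... | true  = cong (λ b → when b 1)
                    (trans (cong (adj G x y ∧_) (cong₂ _∨_ (away x rx) (away y ry))) (∧-zeroʳ (adj G x y)))

  degreeSum-Star : degreeSum (Star G i j) ≡ (0 + (deg V⊖i j + deg V⊖i j)) + (deg V i + deg V i)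
  degreeSum-Star = trans (degSum-⊖ V i refl)
    (cong (_+ (deg V i + deg V i)) (trans (degSum-⊖ V⊖i j j∈V⊖i) (cong (_+ (deg V⊖i j + deg V⊖i j)) rest-degSum)))

  -- If i, j are non-adjacent, each has at most p star neighbours.
  nonAdjacentBound : adj G i j ≡ false → degreeSum (Star G i j) ≤ (p + p) + (p + p)
  nonAdjacentBound ij = ≤-trans (≤-reflexive degreeSum-Star) (+-mono-≤ (+-mono-≤ deg-j deg-j) (+-mono-≤ deg-i deg-i))
    where
      V⊖j = V ⊖ j
      i∈V⊖j : V⊖j i ≡ true
      i∈V⊖j = ⊖-keeps V j i refl (≢⇒==-false i≢j)
      size-V⊖j⊖i : size (V⊖j ⊖ i) ≡ p
      size-V⊖j⊖i = +-cancelʳ-≡ 1 _ _ (+-cancelʳ-≡ 1 _ _ (trans (trans (cong (_+ 1) (≡sym (size-⊖ V⊖j i i∈V⊖j)))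
                     (trans (≡sym (size-⊖ V j refl)) (sum-ones n))) n≡p+2))
      deg-i : deg V i ≤ p
      deg-i = ≤-trans (≤-reflexive (trans (deg-⊖ V j refl i)
                (trans (cong (λ b → deg V⊖j i + when (b ∧ touches i j i j) 1) ij) (+-identityʳ _))))
              (≤-trans (≤-reflexive (deg-⊖-self V⊖j i i∈V⊖j)) (≤-trans (deg-≤-size (V⊖j ⊖ i) i) (≤-reflexive size-V⊖j⊖i)))
      deg-j : deg V⊖i j ≤ p
      deg-j = ≤-trans (≤-reflexive (deg-⊖-self V⊖i j j∈V⊖i)) (deg-≤-size rest j)

  -- In a complete graph i has all p + 1 other vertices as star neighbours,
  -- and j all p vertices other than i, j.
  completeExact : IsComplete G → degreeSum (Star G i j) ≡ (0 + (p + p)) + ((p + 1) + (p + 1))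
  completeExact complete = trans degreeSum-Star
    (cong₂ (λ a b → (0 + (a + a)) + (b + b)) (deg-dominating V⊖i j dom-j) (trans (deg-dominating V i dom-i) size-V⊖i))
    where
      dom-i : Dominates V i
      dom-i y _ yi = cong₂ _∧_ (complete i y (λ i≡y → ==-false⇒≢ yi (≡sym i≡y))) (touches-i i j y)
      dom-j : Dominates V⊖i j
      dom-j y _ yj = cong₂ _∧_ (complete j y (λ j≡y → ==-false⇒≢ yj (≡sym j≡y))) (touches-j i j y)

starDeletion : ∀ {n} (G : Graph n) i j → i ≢ j → NoPMNoAPM (G ∖ Star G i j)
starDeletion G i j i≢j = noMatching (G ∖ Star G i j) i j i≢j (Star-isolates-i G i j) (Star-isolates-j G i j)

nonAdjacentStar : ∀ {n} (G : Graph n) i j → i ≢ j → adj G i j ≡ false → edgeCount (Star G i j) < 2 * n ∸ 3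
nonAdjacentStar G i j i≢j ij = subst (edgeCount (Star G i j) <_) (≡sym 2n∸3≡2p+1) (s≤s edges≤)
  where
    open StarDegrees G i j i≢j
    edges≤ : edgeCount (Star G i j) ≤ p + p
    edges≤ = *-cancelˡ-≤ 2 (≤-trans (≤-reflexive (handshake (Star G i j)))
               (≤-trans (nonAdjacentBound ij) (≤-reflexive (e p))))
      where e : ∀ p → (p + p) + (p + p) ≡ 2 * (p + p)
            e = solve-∀

completeStar : ∀ {n} (G : Graph n) i j → i ≢ j → IsComplete G → edgeCount (Star G i j) ≡ 2 * n ∸ 3
completeStar G i j i≢j complete =
  trans (*-cancelˡ-≡ _ _ 2 (trans (handshake (Star G i j)) (trans (completeExact complete) (e p))))
        (≡sym 2n∸3≡2p+1)
  where
    open StarDegrees G i j i≢j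
    e : ∀ p → (0 + (p + p)) + ((p + 1) + (p + 1)) ≡ 2 * suc (p + p)
    e = solve-∀

-- (⇒), for every graph: if two vertices were non-adjacent, deleting their
-- star would destroy all (almost-)perfect matchings with fewer than 2n − 3
-- edges.
onlyIfComplete : ∀ {n} (G : Graph n) → MatchingPreclusionNumber G (2 * n ∸ 3) → IsComplete G
onlyIfComplete G (_ , minimal) i j i≢j with adj G i j in ij
... | true  = refl
... | false = ⊥-elim (<⇒≱ (nonAdjacentStar G i j i≢j ij) (minimal (Star G i j) (Star⊆ G i j) (starDeletion G i j i≢j)))

asAlmostPerfectMatching : ∀ {n} (G F : Graph n) → IsComplete G →
  AlmostPerfect.AlmostPerfectMatching (adj F) (sym F) (irrefl F) (λ _ → true) →
  ∃[ M ] IsAlmostPerfectMatching (G ∖ F) M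
asAlmostPerfectMatching {n} G F complete R =
  M , M⊆ , R.missed , trans (count-sum (R.M R.missed)) R.deg-missed ,
  λ x x≢ → trans (count-sum (R.M x)) (R.deg-other x (≢⇒==-false x≢))
  where
    module R = AlmostPerfect.AlmostPerfectMatching R
    no-loop : ∀ x → R.M x x ≡ false
    no-loop x = true-or-false (λ e → ==-false⇒≢ {i = x} (proj₁ (proj₂ (proj₂ (R.M-edges x x e)))) refl)
    M : Graph n
    M = record { adj = R.M ; sym = R.M-sym ; irrefl = no-loop }
    M⊆ : M ⊆ (G ∖ F)
    M⊆ x y e = let (_ , _ , x≢y , Fxy) = R.M-edges x y e
               in cong₂ (λ a b → a ∧ not b) (complete x y (==-false⇒≢ x≢y)) Fxy

completeLowerBound : ∀ k (G F : Graph (2 * k + 1)) → IsComplete G → NoPMNoAPM (G ∖ F) → capacity k < edgeCount F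
completeLowerBound k G F complete (_ , noAPM) with edgeCount F ≤? capacity k
... | no  many = ≰⇒> many
... | yes few  = ⊥-elim (noAPM (asAlmostPerfectMatching G F complete
                  (almostPerfectMatching k (λ _ → true) (sum-ones (2 * k + 1)) degSum≤)))
  where
    open AlmostPerfect (adj F) (sym F) (irrefl F)
    open RestrictedDegrees (adj F) (sym F) (irrefl F) using (degSum)
    degSum≤ : degSum (λ _ → true) ≤ 2 * capacity k
    degSum≤ = subst (_≤ 2 * capacity k) (handshake F) (*-monoʳ-≤ 2 few)

oddAtLeastNine : ∀ n → n % 2 ≡ 1 → 9 ≤ n → ∃[ j ] n ≡ 2 * (4 + j) + 1
oddAtLeastNine n odd n≥9 = fromHalf (n / 2) n≡ (subst (9 ≤_) n≡ n≥9)
  where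
    n≡ : n ≡ 2 * (n / 2) + 1
    n≡ = trans (m≡m%n+[m/n]*n n 2) (trans (cong (_+ (n / 2) * 2) odd) (e (n / 2)))
      where e : ∀ k → 1 + k * 2 ≡ 2 * k + 1
            e = solve-∀
    fromHalf : ∀ k → n ≡ 2 * k + 1 → 9 ≤ 2 * k + 1 → ∃[ j ] n ≡ 2 * (4 + j) + 1
    fromHalf (suc (suc (suc (suc j)))) e _ = j , e
    fromHalf 0 _ (s≤s ())
    fromHalf 1 _ (s≤s (s≤s (s≤s ())))
    fromHalf 2 _ (s≤s (s≤s (s≤s (s≤s (s≤s ())))))
    fromHalf 3 _ (s≤s (s≤s (s≤s (s≤s (s≤s (s≤s (s≤s ())))))))

2n∸3-capacity : ∀ j → 2 * (2 * (4 + j) + 1) ∸ 3 ≡ suc (capacity (4 + j))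
2n∸3-capacity j = trans (cong (_∸ 3) (e j)) (m+n∸m≡n 3 (15 + 4 * j))
  where e : ∀ j → 2 * (2 * (4 + j) + 1) ≡ 3 + (15 + 4 * j)
        e = solve-∀

proposition3p7 : (n : ℕ) → n % 2 ≡ 1 → 9 ≤ n → (G : Graph n) →
    (MatchingPreclusionNumber G (2 * n ∸ 3) → IsComplete G) × (IsComplete G → MatchingPreclusionNumber G (2 * n ∸ 3))
proposition3p7 n odd n≥9 G with oddAtLeastNine n odd n≥9
... | j , refl = onlyIfComplete G , λ complete →
  (Star G zero (suc zero) , Star⊆ G zero (suc zero) , completeStar G zero (suc zero) (λ ()) complete ,
   starDeletion G zero (suc zero) (λ ())) ,
  λ F _ destroyed → subst (_≤ edgeCount F) (≡sym (2n∸3-capacity j)) (completeLowerBound (4 + j) G F complete destroyed)
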